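{- Suppose that every finite independent union-closed family $\mathcal{G}$ with $\mathcal{G}\notin\{\emptyset,\{\emptyset\}\}$ has an element $x\in U(\mathcal{G})$ with $|\mathcal{G}_x|\ge\frac{|\mathcal{G}|}{2}$. Then every finite union-closed family $\mathcal{F}$ with $\mathcal{F}\notin\{\emptyset,\{\emptyset\}\}$ has an element $a\in U(\mathcal{F})$ with $|\mathcal{F}_a|\ge\frac{|\mathcal{F}|}{2}$.
   Context: $U(\mathcal{F})$ is the union of the members of $\mathcal{F}$; $\mathcal{F}_a=\{F\in\mathcal{F}:a\in F\}$, $\mathcal{F}_{\tilde a}=\{F\in\mathcal{F}:a\notin F\}$. $\mathcal{F}$ is union-closed if $F\cup G\in\mathcal{F}$ for all $F,G\in\mathcal{F}$. $\mathcal{F}$ is independent if for every $a\in U(\mathcal{F})$ and every $S\subseteq U(\mathcal{F})\setminus\{a\}$ at least one holds: (i) there is $O\in\mathcal{F}_{\tilde a}$ with $O\cap S\neq\emptyset$; (ii) there is $O\in\mathcal{F}_a$ with $O\cap S=\emptyset$. -}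

module Defs where

open import Data.Nat using (ℕ; _*_; _≥_)
open import Data.Fin using (Fin)
open import Data.Fin.Subset using (Subset; _∈_; _∉_; _∪_; _∩_; ⊥; Nonempty; Empty)
open import Data.Fin.Subset.Properties using (_∈?_)
open import Data.List using (List; []; _∷_; length; filter)
import Data.List.Membership.Propositional as L
open import Data.List.Relation.Unary.Unique.Propositional using (Unique)
open import Data.Product using (Σ; ∃; _×_)
open import Data.Sum using (_⊎_)
open import Relation.Binary.PropositionalEquality using (_≢_)

-- A finite family of subsets of the ground set Fin n, given as a
-- duplicate-free list of its members (order irrelevant).
record Family (n : ℕ) : Set where
  constructor mkFamily
  field
    members : List (Subset n)
    unique  : Unique members
open Family public

_∈F_ : ∀ {n} → Subset n → Family n → Set
A ∈F 𝓕 = A L.∈ members 𝓕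

size : ∀ {n} → Family n → ℕ
size 𝓕 = length (members 𝓕)

withElem : ∀ {n} → Family n → Fin n → List (Subset n)
withElem 𝓕 a = filter (a ∈?_) (members 𝓕)

countWith : ∀ {n} → Family n → Fin n → ℕ
countWith 𝓕 a = length (withElem 𝓕 a)

_∈U_ : ∀ {n} → Fin n → Family n → Set
a ∈U 𝓕 = Σ (Subset _) λ F → F ∈F 𝓕 × a ∈ F

UnionClosed : ∀ {n} → Family n → Set
UnionClosed 𝓕 = ∀ F G → F ∈F 𝓕 → G ∈F 𝓕 → (F ∪ G) ∈F 𝓕

SubsetOfUMinus : ∀ {n} → Subset n → Family n → Fin n → Set
SubsetOfUMinus S 𝓕 a = ∀ x → x ∈ S → (x ∈U 𝓕) × (x ≢ a)

Independent : ∀ {n} → Family n → Set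
Independent 𝓕 =
  ∀ a → a ∈U 𝓕 → ∀ S → SubsetOfUMinus S 𝓕 a →
    (Σ (Subset _) λ O → O ∈F 𝓕 × a ∉ O × Nonempty (O ∩ S))
    ⊎ (Σ (Subset _) λ O → O ∈F 𝓕 × a ∈ O × Empty (O ∩ S))

NonTrivial : ∀ {n} → Family n → Set
NonTrivial 𝓕 = (members 𝓕 ≢ []) × (members 𝓕 ≢ (⊥ ∷ []))

HasAbundantElement : ∀ {n} → Family n → Set
HasAbundantElement 𝓕 = ∃ λ a → a ∈U 𝓕 × 2 * countWith 𝓕 a ≥ size 𝓕

-- Say 𝓕 is independent at a when some O ∈ 𝓕_a has O ∖ {a} ⊆ U(𝓕_ã).  This gives
-- the independence condition at a: for S ⊆ U(𝓕) ∖ {a}, either S meets U(𝓕_ã),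
-- which is (i), or O is a witness for (ii).  If 𝓕 fails to be independent at
-- some a ∈ U(𝓕), then F ∖ {a} ∉ 𝓕 for every F ∈ 𝓕_a (otherwise F would be such
-- an O), so F ↦ F ∖ {a} is injective on 𝓕.  Its image 𝓕 - a is union-closed and
-- nontrivial (were it {∅}, then 𝓕 = {X} with X ⊆ {a}, independent at a), has the
-- same frequencies |𝓕_x| for x ≠ a, and has smaller total size Σ_F |F|.
-- Induction on the total size therefore reduces to independent families.
module Submission where

open import Defs
open import Data.Bool using (true; false; _∨_)
open import Data.Empty using (⊥-elim)
open import Data.Fin using (Fin; _≟_)
open import Data.Fin.Properties using (any?)
open import Data.Fin.Subset
  using (Subset; inside; outside; _∈_; _∉_; _⊆_; _∪_; _∩_; _─_; _-_; ⁅_⁆; ⋃; ∣_∣)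
  renaming (⊥ to ∅)
open import Data.Fin.Subset.Properties
  using ( _∈?_; _⊆?_; nonempty?; ∉⊥; x∈⁅x⁆; ⊆-antisym; p─q⊆p; x∈p∧x≢y⇒x∈p-y
        ; p⊆p∪q; q⊆p∪q; x∈p∪q⁻; x∈p∩q⁺; x∈p∩q⁻; ∣p─q∣≤∣p∣; x∈p⇒∣p-x∣<∣p∣ )
open import Data.List using (List; []; _∷_; map; filter; length)
open import Data.Vec using ([]; _∷_; here; there)
open import Data.List.Properties using (length-map; map-∘; filter-≐; ∷-injectiveˡ)
open import Data.List.Membership.Propositional using (find; lose)
import Data.List.Membership.Propositional as List
open import Data.List.Membership.Propositional.Properties
  using (∉[]; ∈-map⁺; ∈-map⁻; ∈-filter⁺; ∈-filter⁻)
import Data.List.Relation.Unary.All as All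
import Data.List.Relation.Unary.All.Properties as All
open import Data.List.Relation.Unary.Any as Any using (Any; here; there)
open import Data.List.Relation.Unary.AllPairs using ([]; _∷_)
open import Data.List.Relation.Unary.Unique.Propositional using (Unique)
open import Data.Nat using (ℕ; z≤n; _*_; _≤_; _<_; _≥_)
open import Data.Nat.Induction using (<-wellFounded)
open import Data.Nat.ListAction using (sum)
open import Data.Nat.Properties using (+-mono-≤; +-mono-<-≤; +-mono-≤-<; module ≤-Reasoning)
open import Data.Product using (∃; _×_; _,_; proj₂)
open import Data.Sum using (_⊎_; inj₁; inj₂)
open import Function using (_∘_)
import Induction.WellFounded as WF
open import Level using (0ℓ)
open import Relation.Binary.Construct.On as On using ()
open import Relation.Nullary using (¬_; Dec; does; yes; no; ¬?; _×-dec_)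
open import Relation.Nullary.Decidable using (decidable-stable)
open import Relation.Unary using (_≐_)
open import Relation.Binary.PropositionalEquality
  using (_≡_; _≢_; refl; sym; trans; cong; subst; subst₂; module ≡-Reasoning)

private
  variable
    n : ℕ

x∈p─q⇒x∉q : ∀ {x : Fin n} {p q} → x ∈ p ─ q → x ∉ q
x∈p─q⇒x∉q {p = _ ∷ _} {outside ∷ _} here ()
x∈p─q⇒x∉q {p = _ ∷ _} {_ ∷ _} (there x∈p─q) (there x∈q) = x∈p─q⇒x∉q x∈p─q x∈q

x∈p-y⇒x∈p : ∀ {x y : Fin n} {p} → x ∈ p - y → x ∈ p
x∈p-y⇒x∈p {y = y} {p} = p─q⊆p p ⁅ y ⁆

x∈p-y⇒x≢y : ∀ {x y : Fin n} {p} → x ∈ p - y → x ≢ y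
x∈p-y⇒x≢y x∈p-y refl = x∈p─q⇒x∉q x∈p-y (x∈⁅x⁆ _)

x∉p⇒p-x≡p : ∀ {x : Fin n} {p} → x ∉ p → p - x ≡ p
x∉p⇒p-x≡p {x = x} {p} x∉p = ⊆-antisym x∈p-y⇒x∈p p⊆p-x
  where
  p⊆p-x : p ⊆ p - x
  p⊆p-x y∈p = x∈p∧x≢y⇒x∈p-y y∈p λ { refl → x∉p y∈p }

p-x≡q-x⇒p≡q : ∀ {x : Fin n} {p q} → x ∈ p → x ∈ q → p - x ≡ q - x → p ≡ q
p-x≡q-x⇒p≡q x∈p x∈q e = ⊆-antisym (⊆-from x∈q e) (⊆-from x∈p (sym e))
  where
  ⊆-from : ∀ {x : Fin n} {p q} → x ∈ q → p - x ≡ q - x → p ⊆ q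
  ⊆-from {x = x} x∈q e {y} y∈p with y ≟ x
  ... | yes refl = x∈q
  ... | no y≢x   = x∈p-y⇒x∈p (subst (y ∈_) e (x∈p∧x≢y⇒x∈p-y y∈p y≢x))

─-distribʳ-∪ : ∀ (p q r : Subset n) → (p ∪ q) ─ r ≡ (p ─ r) ∪ (q ─ r)
─-distribʳ-∪ []      []      []            = refl
─-distribʳ-∪ (s ∷ p) (t ∷ q) (inside  ∷ r) = cong (outside ∷_) (─-distribʳ-∪ p q r)
─-distribʳ-∪ (s ∷ p) (t ∷ q) (outside ∷ r) = cong ((s ∨ t) ∷_) (─-distribʳ-∪ p q r)

∈⇒⊆⋃ : ∀ {p : Subset n} {ps} → p List.∈ ps → p ⊆ ⋃ ps
∈⇒⊆⋃ {ps = q ∷ ps} (here refl) = p⊆p∪q (⋃ ps)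
∈⇒⊆⋃ {ps = q ∷ ps} (there p∈ps) = q⊆p∪q q (⋃ ps) ∘ ∈⇒⊆⋃ p∈ps

∈⋃⁻ : ∀ {x : Fin n} ps → x ∈ ⋃ ps → ∃ λ p → p List.∈ ps × x ∈ p
∈⋃⁻ []       x∈∅ = ⊥-elim (∉⊥ x∈∅)
∈⋃⁻ (p ∷ ps) x∈⋃ with x∈p∪q⁻ p (⋃ ps) x∈⋃
... | inj₁ x∈p   = p , here refl , x∈p
... | inj₂ x∈⋃ps = let q , q∈ps , x∈q = ∈⋃⁻ ps x∈⋃ps in q , there q∈ps , x∈q

module _ {A B : Set} where

  unique-map⁺ : ∀ {f : A → B} {xs} →
    (∀ {x y} → x List.∈ xs → y List.∈ xs → f x ≡ f y → x ≡ y) →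
    Unique xs → Unique (map f xs)
  unique-map⁺ inj [] = []
  unique-map⁺ inj (x≢xs ∷ xs!) =
    All.map⁺ (All.tabulate λ y∈xs fx≡fy → All.lookup x≢xs y∈xs (inj (here refl) (there y∈xs) fx≡fy))
    ∷ unique-map⁺ (λ x∈ y∈ → inj (there x∈) (there y∈)) xs!

  filter-map : ∀ (f : A → B) {P : B → Set} (P? : ∀ y → Dec (P y)) xs →
    filter P? (map f xs) ≡ map f (filter (P? ∘ f) xs)
  filter-map f P? []       = refl
  filter-map f P? (x ∷ xs) with does (P? (f x))
  ... | true  = cong (f x ∷_) (filter-map f P? xs)
  ... | false = filter-map f P? xs

module _ {A : Set} where

  sum-map-≤ : ∀ {f g : A → ℕ} → (∀ x → f x ≤ g x) → ∀ xs → sum (map f xs) ≤ sum (map g xs)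
  sum-map-≤ f≤g []       = z≤n
  sum-map-≤ f≤g (x ∷ xs) = +-mono-≤ (f≤g x) (sum-map-≤ f≤g xs)

  sum-map-< : ∀ {f g : A → ℕ} {xs} → (∀ x → f x ≤ g x) → Any (λ x → f x < g x) xs →
    sum (map f xs) < sum (map g xs)
  sum-map-< {xs = x ∷ xs} f≤g (here fx<gx) = +-mono-<-≤ fx<gx (sum-map-≤ f≤g xs)
  sum-map-< {xs = x ∷ xs} f≤g (there f<g)  = +-mono-≤-< (f≤g x) (sum-map-< f≤g f<g)

withoutElem : Family n → Fin n → List (Subset n)
withoutElem 𝓕 a = filter (λ F → ¬? (a ∈? F)) (members 𝓕)

IndependentAt : Family n → Fin n → Set
IndependentAt 𝓕 a = Any (λ O → a ∈ O × O - a ⊆ ⋃ (withoutElem 𝓕 a)) (members 𝓕)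

independentAt? : ∀ (𝓕 : Family n) a → Dec (IndependentAt 𝓕 a)
independentAt? 𝓕 a = Any.any? (λ O → a ∈? O ×-dec O - a ⊆? ⋃ (withoutElem 𝓕 a)) (members 𝓕)

independentAt⇒independent : ∀ (𝓕 : Family n) → (∀ a → a ∈U 𝓕 → IndependentAt 𝓕 a) → Independent 𝓕
independentAt⇒independent 𝓕 ind a a∈U S S⊆U-a with nonempty? (S ∩ ⋃ (withoutElem 𝓕 a))
... | yes (x , x∈S∩⋃) =
  let x∈S , x∈⋃       = x∈p∩q⁻ S _ x∈S∩⋃
      O , O∈𝓕ã , x∈O   = ∈⋃⁻ _ x∈⋃
      O∈𝓕 , a∉O       = ∈-filter⁻ (λ F → ¬? (a ∈? F)) O∈𝓕ã
  in inj₁ (O , O∈𝓕 , a∉O , x , x∈p∩q⁺ (x∈O , x∈S))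
... | no S∩⋃-empty =
  let O , O∈𝓕 , a∈O , O-a⊆⋃ = find (ind a a∈U) in
  inj₂ (O , O∈𝓕 , a∈O , λ (x , x∈O∩S) →
    let x∈O , x∈S = x∈p∩q⁻ O S x∈O∩S in
    S∩⋃-empty (x , x∈p∩q⁺ (x∈S , O-a⊆⋃ (x∈p∧x≢y⇒x∈p-y x∈O (proj₂ (S⊆U-a x x∈S))))))

independent⊎dependentElement : ∀ (𝓕 : Family n) →
  Independent 𝓕 ⊎ ∃ λ a → a ∈U 𝓕 × ¬ IndependentAt 𝓕 a
independent⊎dependentElement 𝓕
  with any? (λ a → a ∈? ⋃ (members 𝓕) ×-dec ¬? (independentAt? 𝓕 a))
... | yes (a , a∈⋃ , ¬ind) = inj₂ (a , ∈⋃⁻ _ a∈⋃ , ¬ind)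
... | no ∄dependent = inj₁ (independentAt⇒independent 𝓕 λ a (F , F∈𝓕 , a∈F) →
  decidable-stable (independentAt? 𝓕 a) λ ¬ind → ∄dependent (a , ∈⇒⊆⋃ F∈𝓕 a∈F , ¬ind))

removal≡[∅]⇒independentAt : ∀ (𝓕 : Family n) {a} → a ∈U 𝓕 →
  map (_- a) (members 𝓕) ≡ ∅ ∷ [] → IndependentAt 𝓕 a
removal≡[∅]⇒independentAt (mkFamily (X ∷ []) _) (_ , here refl , a∈X) X-a≡∅ =
  here (a∈X , λ x∈X-a → ⊥-elim (∉⊥ (subst (_ ∈_) (∷-injectiveˡ X-a≡∅) x∈X-a)))

weight : Family n → ℕ
weight 𝓕 = sum (map ∣_∣ (members 𝓕))

module Removal (𝓕 : Family n) (a : Fin n) (¬ind : ¬ IndependentAt 𝓕 a) where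

  F-a∉𝓕 : ∀ {F} → F ∈F 𝓕 → a ∈ F → ¬ ((F - a) ∈F 𝓕)
  F-a∉𝓕 {F} F∈𝓕 a∈F F-a∈𝓕 = ¬ind (lose F∈𝓕 (a∈F , ∈⇒⊆⋃ F-a∈𝓕ã))
    where
    F-a∈𝓕ã : (F - a) List.∈ withoutElem 𝓕 a
    F-a∈𝓕ã = ∈-filter⁺ (λ G → ¬? (a ∈? G)) F-a∈𝓕 λ a∈F-a → x∈p-y⇒x≢y a∈F-a refl

  -a-injectiveOn𝓕 : ∀ {p q} → p ∈F 𝓕 → q ∈F 𝓕 → p - a ≡ q - a → p ≡ q
  -a-injectiveOn𝓕 {p} {q} p∈𝓕 q∈𝓕 e with a ∈? p | a ∈? q
  ... | yes a∈p | yes a∈q = p-x≡q-x⇒p≡q a∈p a∈q e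
  ... | no a∉p  | no a∉q  = trans (sym (x∉p⇒p-x≡p a∉p)) (trans e (x∉p⇒p-x≡p a∉q))
  ... | yes a∈p | no a∉q  = ⊥-elim (F-a∉𝓕 p∈𝓕 a∈p (subst (_∈F 𝓕) (sym (trans e (x∉p⇒p-x≡p a∉q))) q∈𝓕))
  ... | no a∉p  | yes a∈q = ⊥-elim (F-a∉𝓕 q∈𝓕 a∈q (subst (_∈F 𝓕) (trans (sym (x∉p⇒p-x≡p a∉p)) e) p∈𝓕))

  𝓕-a : Family n
  𝓕-a = mkFamily (map (_- a) (members 𝓕)) (unique-map⁺ -a-injectiveOn𝓕 (unique 𝓕))

  unionClosed : UnionClosed 𝓕 → UnionClosed 𝓕-a
  unionClosed uc _ _ F-a∈ G-a∈ with ∈-map⁻ (_- a) F-a∈ | ∈-map⁻ (_- a) G-a∈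
  ... | F , F∈𝓕 , refl | G , G∈𝓕 , refl =
    subst (_∈F 𝓕-a) (─-distribʳ-∪ F G ⁅ a ⁆) (∈-map⁺ (_- a) (uc F G F∈𝓕 G∈𝓕))

  nonTrivial : a ∈U 𝓕 → NonTrivial 𝓕-a
  nonTrivial a∈U@(F , F∈𝓕 , _) =
    (λ e → ∉[] (subst (F - a List.∈_) e (∈-map⁺ (_- a) F∈𝓕))) ,
    ¬ind ∘ removal≡[∅]⇒independentAt 𝓕 a∈U

  weight-decreasing : a ∈U 𝓕 → weight 𝓕-a < weight 𝓕
  weight-decreasing (F , F∈𝓕 , a∈F) = begin-strict
    sum (map ∣_∣ (map (_- a) xs))  ≡⟨ cong sum (map-∘ {g = ∣_∣} {f = _- a} xs) ⟨
    sum (map (∣_∣ ∘ (_- a)) xs)    <⟨ sum-map-< {xs = xs} (λ p → ∣p─q∣≤∣p∣ p ⁅ a ⁆)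
                                                          (lose F∈𝓕 (x∈p⇒∣p-x∣<∣p∣ a∈F)) ⟩
    sum (map ∣_∣ xs)               ∎
    where
    open ≤-Reasoning
    xs : List (Subset n)
    xs = members 𝓕

  countWith-preserved : ∀ {x} → x ≢ a → countWith 𝓕-a x ≡ countWith 𝓕 x
  countWith-preserved {x} x≢a = begin
    length (filter (x ∈?_) (map (_- a) xs))              ≡⟨ cong length (filter-map (_- a) (x ∈?_) xs) ⟩
    length (map (_- a) (filter (λ F → x ∈? F - a) xs))   ≡⟨ length-map (_- a) (filter (λ F → x ∈? F - a) xs) ⟩
    length (filter (λ F → x ∈? F - a) xs)                ≡⟨ cong length (filter-≐ _ _ x∈F-a⇔x∈F xs) ⟩
    length (filter (x ∈?_) xs)                           ∎
    where
    open ≡-Reasoning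
    xs : List (Subset n)
    xs = members 𝓕
    x∈F-a⇔x∈F : (λ F → x ∈ F - a) ≐ (x ∈_)
    x∈F-a⇔x∈F = x∈p-y⇒x∈p , λ x∈F → x∈p∧x≢y⇒x∈p-y x∈F x≢a

  abundant-lift : HasAbundantElement 𝓕-a → HasAbundantElement 𝓕
  abundant-lift (x , (_ , G-a∈𝓕-a , x∈G-a) , abundant) with ∈-map⁻ (_- a) G-a∈𝓕-a
  ... | G , G∈𝓕 , refl =
    x , (G , G∈𝓕 , x∈p-y⇒x∈p x∈G-a) ,
    subst₂ (λ c s → 2 * c ≥ s) (countWith-preserved (x∈p-y⇒x≢y x∈G-a))
                               (length-map (_- a) (members 𝓕)) abundant

proposition2p5 : (∀ (m : ℕ) (𝓖 : Family m) → Independent 𝓖 → UnionClosed 𝓖 → NonTrivial 𝓖 → HasAbundantElement 𝓖) →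
    ∀ (n : ℕ) (𝓕 : Family n) → UnionClosed 𝓕 → NonTrivial 𝓕 → HasAbundantElement 𝓕
proposition2p5 independentCase n = wfRec _ step
  where
  open WF.All (On.wellFounded weight <-wellFounded) 0ℓ

  Frankl : ∀ {n} → Family n → Set
  Frankl 𝓕 = UnionClosed 𝓕 → NonTrivial 𝓕 → HasAbundantElement 𝓕

  step : ∀ 𝓕 → (∀ {𝓖} → weight 𝓖 < weight 𝓕 → Frankl 𝓖) → Frankl 𝓕
  step 𝓕 ih uc nt with independent⊎dependentElement 𝓕
  ... | inj₁ ind                 = independentCase n 𝓕 ind uc nt
  ... | inj₂ (a , a∈U , ¬indAt) =
    abundant-lift (ih {𝓕-a} (weight-decreasing a∈U) (unionClosed uc) (nonTrivial a∈U))
    where open Removal 𝓕 a ¬indAt
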